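{- Let $n,k$ be integers with $n>2k\ge 4$, and let $X=\{1,\ldots,n\}$. Suppose $\mathcal F \subset \binom{X}{k}$ is a saturated intersecting family, let $\mathcal B=\mathcal B(\mathcal F)$ be the family of inclusion-minimal sets in $\mathcal T(\mathcal F)$, and let $t := \min\{|B|\colon B\in\mathcal B\}$. For $t\le \ell\le k$ let $\mathcal F^{(\ell)}$ be the set of $F\in\mathcal F$ with $\max\{|B|\colon B\in\mathcal B,\ B\subset F\}=\ell$, and let $$\mathcal I_\ell := \left\{F\cap F'\colon F\in\mathcal F^{(\ell)},\ F'\in \mathcal F^{(t)}\cup\cdots\cup\mathcal F^{(\ell)}\right\}.$$ Then for any $t \leq \ell \leq k$ such that $\tau(\mathcal B^{(\le \ell)}) \geq 2$ we have $$|\mathcal I_\ell| \leq (2^\ell - 1)\,|\mathcal B^{(\ell)}| \sum_{0 \leq i \leq k - \ell} \binom{n}{i} < 2^\ell \cdot \ell^2 k^{\ell - 2} \sum_{0 \leq i \leq k - \ell} \binom{n}{i}.$$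
   Context: $\binom{X}{k}$ denotes the family of all $k$-subsets of $X$. A family $\mathcal F$ is intersecting if $F\cap F'\neq\emptyset$ for all $F,F'\in\mathcal F$. An intersecting family $\mathcal F \subset \binom{X}{k}$ is saturated if $\mathcal F \cup \{G\}$ is not intersecting for every $G \in \binom{X}{k}\setminus \mathcal F$. For $\mathcal G \subset 2^X$, $\mathcal T(\mathcal G) := \{T \subset X\colon |T| \leq k,\ T \cap G \neq \emptyset \text{ for all } G \in \mathcal G\}$. For a family $\mathcal G$, $\mathcal G^{(j)} := \{G \in \mathcal G\colon |G| = j\}$ and $\mathcal G^{(\le \ell)} := \bigcup_{i=1}^{\ell} \mathcal G^{(i)}$. The covering number is $\tau(\mathcal G) := \min\{|T|\colon T \cap G \neq \emptyset \text{ for all } G \in \mathcal G\}$. -}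

module Defs where

open import Data.Nat using (ℕ; zero; suc; _≤_; _≤ᵇ_; _≡ᵇ_; _⊔_)
open import Data.Bool using (Bool; true; false; _∧_; _∨_; not; T)
import Data.Bool as Bool
open import Data.Fin.Subset using (Subset; inside; outside; _∩_; ∣_∣; Nonempty)
open import Data.Fin.Subset.Properties using (nonempty?; _⊆?_; _⊂?_)
open import Data.List using (List; []; _∷_; map; _++_; filterᵇ; length; foldr)
open import Data.Bool.ListAction using (all; any)
open import Relation.Nullary using (¬_)
open import Data.Vec using (Vec)
import Data.Vec as Vec
open import Data.Vec.Properties using (≡-dec)
open import Data.Product using (Σ; _×_; _,_)
open import Relation.Nullary.Decidable using (⌊_⌋)
open import Relation.Binary.PropositionalEquality using (_≡_)

-- The ground set X = {1,…,n} is modelled as Fin n; subsets of X are Subset n.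

allSubsets : (n : ℕ) → List (Subset n)
allSubsets zero    = Vec.[] ∷ []
allSubsets (suc n) = map (outside Vec.∷_) (allSubsets n) ++ map (inside Vec.∷_) (allSubsets n)

Family : ℕ → Set
Family n = Subset n → Bool

module _ {n : ℕ} where

  _∈ᶠ_ : Subset n → Family n → Set
  A ∈ᶠ 𝓕 = T (𝓕 A)

  _=ˢ_ : Subset n → Subset n → Bool
  A =ˢ B = ⌊ ≡-dec Bool._≟_ A B ⌋

  #_ : Family n → ℕ
  # 𝓕 = length (filterᵇ 𝓕 (allSubsets n))

  IsUniform : ℕ → Family n → Set
  IsUniform k 𝓕 = ∀ A → A ∈ᶠ 𝓕 → ∣ A ∣ ≡ k

  Intersecting : Family n → Set
  Intersecting 𝓕 = ∀ A B → A ∈ᶠ 𝓕 → B ∈ᶠ 𝓕 → Nonempty (A ∩ B)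

  insertᶠ : Subset n → Family n → Family n
  insertᶠ G 𝓕 A = 𝓕 A ∨ (A =ˢ G)

  Saturated : ℕ → Family n → Set
  Saturated k 𝓕 = Intersecting 𝓕 ×
    (∀ G → ∣ G ∣ ≡ k → ¬ (G ∈ᶠ 𝓕) → ¬ Intersecting (insertᶠ G 𝓕))

  𝓣 : ℕ → Family n → Family n
  𝓣 k 𝓖 S = (∣ S ∣ ≤ᵇ k) ∧ all (λ G → not (𝓖 G) ∨ ⌊ nonempty? (S ∩ G) ⌋) (allSubsets n)

  minimalᶠ : Family n → Family n
  minimalᶠ 𝓖 S = 𝓖 S ∧ not (any (λ S' → 𝓖 S' ∧ ⌊ S' ⊂? S ⌋) (allSubsets n))

  𝓑 : ℕ → Family n → Family n
  𝓑 k 𝓕 = minimalᶠ (𝓣 k 𝓕)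

  layer : Family n → ℕ → Family n
  layer 𝓖 j S = 𝓖 S ∧ (∣ S ∣ ≡ᵇ j)

  upTo-layer : Family n → ℕ → Family n
  upTo-layer 𝓖 ℓ S = 𝓖 S ∧ (1 ≤ᵇ ∣ S ∣) ∧ (∣ S ∣ ≤ᵇ ℓ)

  Covers : Family n → Subset n → Set
  Covers 𝓖 S = ∀ G → G ∈ᶠ 𝓖 → Nonempty (S ∩ G)

  τ≥ : ℕ → Family n → Set
  τ≥ m 𝓖 = ∀ S → Covers 𝓖 S → m ≤ ∣ S ∣

  -- max{ |B| : B ∈ 𝓑, B ⊂ F }  (0 if there is no such B)
  maxBin : Family n → Subset n → ℕ
  maxBin 𝓑' F = foldr _⊔_ 0 (map ∣_∣ (filterᵇ (λ B → 𝓑' B ∧ ⌊ B ⊆? F ⌋) (allSubsets n)))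

  Flevel : Family n → Family n → ℕ → Family n
  Flevel 𝓕 𝓑' ℓ F = 𝓕 F ∧ (maxBin 𝓑' F ≡ᵇ ℓ)

  FlevelRange : Family n → Family n → ℕ → ℕ → Family n
  FlevelRange 𝓕 𝓑' t ℓ F = 𝓕 F ∧ (t ≤ᵇ maxBin 𝓑' F) ∧ (maxBin 𝓑' F ≤ᵇ ℓ)

  𝓘 : Family n → Family n → ℕ → ℕ → Family n
  𝓘 𝓕 𝓑' t ℓ I =
    any (λ F → Flevel 𝓕 𝓑' ℓ F ∧
      any (λ F' → FlevelRange 𝓕 𝓑' t ℓ F' ∧ ((F ∩ F') =ˢ I)) (allSubsets n))
      (allSubsets n)

  IsMinSize : Family n → ℕ → Set
  IsMinSize 𝓖 t = Σ (Subset n) (λ B → B ∈ᶠ 𝓖 × ∣ B ∣ ≡ t) × (∀ B → B ∈ᶠ 𝓖 → t ≤ ∣ B ∣)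

-- Saturation together
-- with n > 2k makes 𝓑 intersecting: a disjoint pair B₁, B₂ would let B₁ grow to a k-set avoiding
-- B₂, which meets every member of 𝓕 and is therefore forced into 𝓕 by saturation.
--
-- Members of 𝓑^(ℓ) above a set P are few: if P is not a transversal it misses some F ∈ 𝓕, and
-- every member above P contains P ∪ {z} for some z ∈ F; iterating gives at most k^(ℓ−|P|) of them.
-- As τ(𝓑^(≤ℓ)) ≥ 2 there is a member G₁ and, for every x ∈ G₁, a member avoiding x; since 𝓑 is
-- intersecting, every B ∈ 𝓑^(ℓ) contains such a pair x, y, so |𝓑^(ℓ)| ≤ ℓ² k^(ℓ−2).
--
-- Finally F ∈ 𝓕^(ℓ) contains some B ∈ 𝓑^(ℓ), and I = F ∩ F' is determined by its trace I ∩ B,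
-- a nonempty subset of B (B meets F'), and its excess I ∖ B ⊆ F ∖ B, of size at most k − ℓ.

module Submission where

open import Defs
open import Data.Bool using (Bool; true; false; _∧_; _∨_; not; T; T?)
import Data.Bool as Bool
open import Data.Bool.Properties using (T-∧; T-∨; ∧-identityʳ)
open import Data.Bool.ListAction using (any; all)
open import Data.Empty using (⊥-elim)
open import Data.Fin using (Fin; zero; suc)
import Data.Fin as Fin
open import Data.Fin.Properties using (any?)
open import Data.Fin.Subset
  using (Subset; inside; outside; _∩_; _∪_; _─_; ⊥; ⁅_⁆; ∣_∣; _∈_; _∉_; _⊆_; _⊂_; Nonempty; Empty)
open import Data.Fin.Subset.Properties
open import Data.List using (List; []; _∷_; map; _++_; filterᵇ; length; upTo; allFin; tabulate)
open import Data.List.Properties using (length-++; filter-++; map-tabulate; map-cong)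
open import Data.List.Membership.Propositional using (lose) renaming (_∈_ to _∈ˡ_)
open import Data.List.Membership.Propositional.Properties
  using (∈-++⁺ˡ; ∈-++⁺ʳ; ∈-map⁺; ∈-map⁻; ∈-filter⁻; ∈-allFin; ∈-upTo⁺; foldr-selective)
open import Data.List.Relation.Unary.Any using (Any; here; there)
import Data.List.Relation.Unary.Any as Any
open import Data.List.Relation.Unary.Any.Properties using (any⁺; any⁻)
import Data.List.Relation.Unary.All as All
open import Data.List.Relation.Unary.All.Properties using (all⁺; all⁻)
open import Data.Nat using (ℕ; zero; suc; _≤_; _<_; _+_; _*_; _∸_; _^_; z≤n; s≤s; z<s; >-nonZero; _≤ᵇ_; _≡ᵇ_)
open import Data.Nat.Properties
open import Data.Nat.ListAction using (sum)
open import Data.Nat.Combinatorics using (_C_; nCk+nC[k+1]≡[n+1]C[k+1])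
open import Data.Product using (∃; _×_; _,_; proj₁; proj₂)
open import Data.Sum using (_⊎_; inj₁; inj₂)
open import Data.Unit using (tt)
open import Data.Vec using (_∷_; []; here; there)
open import Data.Vec.Properties using (≡-dec)
open import Function using (_∘_)
open import Function.Bundles using (Equivalence)
open import Relation.Binary.PropositionalEquality
  using (_≡_; _≢_; refl; sym; trans; cong; cong₂; subst; subst₂; module ≡-Reasoning)
open import Relation.Nullary using (¬_; ¬?; yes; no; contradiction; _×-dec_)
open import Relation.Nullary.Decidable
  using (⌊_⌋; does; toWitness; fromWitness; isYes≗does; ⌊⌋-map′; decidable-stable)

private variable
  A I : Set

count : (A → Bool) → List A → ℕ
count p xs = length (filterᵇ p xs)

count-mono : {p q : A → Bool} (xs : List A) → (∀ x → T (p x) → T (q x)) → count p xs ≤ count q xs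
count-mono [] p⇒q = z≤n
count-mono {p = p} {q} (x ∷ xs) p⇒q with p x | q x | p⇒q x
... | true  | true  | _   = s≤s (count-mono xs p⇒q)
... | true  | false | p⇒q = ⊥-elim (p⇒q tt)
... | false | true  | _   = m≤n⇒m≤1+n (count-mono xs p⇒q)
... | false | false | _   = count-mono xs p⇒q

count-cong : {p q : A → Bool} (xs : List A) → (∀ x → p x ≡ q x) → count p xs ≡ count q xs
count-cong [] p≗q = refl
count-cong {p = p} {q} (x ∷ xs) p≗q with p x | q x | p≗q x
... | true  | true  | _ = cong suc (count-cong xs p≗q)
... | false | false | _ = count-cong xs p≗q

count-none : {p : A → Bool} (xs : List A) → (∀ x → ¬ T (p x)) → count p xs ≡ 0
count-none [] _ = refl
count-none {p = p} (x ∷ xs) ¬p with p x | ¬p x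
... | true  | ¬px = ⊥-elim (¬px tt)
... | false | _   = count-none xs ¬p

count-map : {B : Set} (p : A → Bool) (f : B → A) (xs : List B) → count p (map f xs) ≡ count (p ∘ f) xs
count-map p f [] = refl
count-map p f (x ∷ xs) with p (f x)
... | true  = cong suc (count-map p f xs)
... | false = count-map p f xs

count-++ : (p : A → Bool) (xs ys : List A) → count p (xs ++ ys) ≡ count p xs + count p ys
count-++ p xs ys = trans (cong length (filter-++ _ xs ys)) (length-++ (filterᵇ p xs))

count-∨ : (p q : A → Bool) (xs : List A) → count (λ x → p x ∨ q x) xs ≤ count p xs + count q xs
count-∨ p q [] = z≤n
count-∨ p q (x ∷ xs) with p x | q x
... | true  | true  = s≤s (≤-trans (count-∨ p q xs) (≤-trans (n≤1+n _) (≤-reflexive (sym (+-suc _ _)))))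
... | true  | false = s≤s (count-∨ p q xs)
... | false | true  = ≤-trans (s≤s (count-∨ p q xs)) (≤-reflexive (sym (+-suc _ _)))
... | false | false = count-∨ p q xs

count-any : (q : I → A → Bool) (is : List I) (xs : List A) →
  count (λ x → any (λ i → q i x) is) xs ≤ sum (map (λ i → count (q i) xs) is)
count-any q []       xs = ≤-reflexive (count-none xs (λ _ ()))
count-any q (i ∷ is) xs =
  ≤-trans (count-∨ (q i) (λ x → any (λ i → q i x) is) xs) (+-monoʳ-≤ (count (q i) xs) (count-any q is xs))

count-any-∧ : (active : I → Bool) (q : I → A → Bool) (is : List I) (xs : List A) {c : ℕ} →
  (∀ i → T (active i) → count (q i) xs ≤ c) →
  count (λ x → any (λ i → active i ∧ q i x) is) xs ≤ count active is * c
count-any-∧ active q is xs bound = ≤-trans (count-any (λ i x → active i ∧ q i x) is xs) (sum≤ is)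
  where
  sum≤ : ∀ is → sum (map (λ i → count (λ x → active i ∧ q i x) xs) is) ≤ count active is * _
  sum≤ []       = z≤n
  sum≤ (i ∷ is) with active i | bound i
  ... | true  | bound-i = +-mono-≤ (bound-i tt) (sum≤ is)
  ... | false | _       rewrite count-none {p = λ _ → false} xs (λ _ ()) = sum≤ is

count-cover-sum : {p : A → Bool} (q : I → A → Bool) (is : List I) (xs : List A) →
  (∀ x → T (p x) → Any (λ i → T (q i x)) is) →
  count p xs ≤ sum (map (λ i → count (q i) xs) is)
count-cover-sum q is xs cover =
  ≤-trans (count-mono xs (λ x px → any⁺ (λ i → q i x) (cover x px))) (count-any q is xs)

count-cover : {p : A → Bool} (active : I → Bool) (q : I → A → Bool) (is : List I) (xs : List A) {c : ℕ} →
  (∀ x → T (p x) → Any (λ i → T (active i) × T (q i x)) is) →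
  (∀ i → T (active i) → count (q i) xs ≤ c) →
  count p xs ≤ count active is * c
count-cover active q is xs cover bound = ≤-trans
  (count-mono xs (λ x px → any⁺ (λ i → active i ∧ q i x) (Any.map (Equivalence.from T-∧) (cover x px))))
  (count-any-∧ active q is xs bound)

∈-allSubsets : ∀ {n} (S : Subset n) → S ∈ˡ allSubsets n
∈-allSubsets {zero}  []            = here refl
∈-allSubsets {suc n} (outside ∷ S) = ∈-++⁺ˡ (∈-map⁺ (outside ∷_) (∈-allSubsets S))
∈-allSubsets {suc n} (inside  ∷ S) = ∈-++⁺ʳ _ (∈-map⁺ (inside ∷_) (∈-allSubsets S))

#-∷ : ∀ {n} (𝓖 : Family (suc n)) → # 𝓖 ≡ # (𝓖 ∘ (outside ∷_)) + # (𝓖 ∘ (inside ∷_))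
#-∷ {n} 𝓖 = begin
  count 𝓖 (map (outside ∷_) (allSubsets n) ++ map (inside ∷_) (allSubsets n))
    ≡⟨ count-++ 𝓖 (map (outside ∷_) (allSubsets n)) _ ⟩
  count 𝓖 (map (outside ∷_) (allSubsets n)) + count 𝓖 (map (inside ∷_) (allSubsets n))
    ≡⟨ cong₂ _+_ (count-map 𝓖 (outside ∷_) (allSubsets n)) (count-map 𝓖 (inside ∷_) (allSubsets n)) ⟩
  # (𝓖 ∘ (outside ∷_)) + # (𝓖 ∘ (inside ∷_)) ∎
  where open ≡-Reasoning

#-false : ∀ n → # (λ (_ : Subset n) → false) ≡ 0
#-false n = count-none (allSubsets n) (λ _ ())

count-∈-allFin : ∀ {n} (p : Subset n) → count (λ x → ⌊ x ∈? p ⌋) (allFin n) ≡ ∣ p ∣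
count-∈-allFin {zero}  []      = refl
count-∈-allFin {suc n} (b ∷ p) = begin
  count (λ x → ⌊ x ∈? b ∷ p ⌋) (zero ∷ tabulate Fin.suc)
    ≡⟨ cong (count (λ x → ⌊ x ∈? b ∷ p ⌋) ∘ (zero ∷_)) (sym (map-tabulate (λ x → x) Fin.suc)) ⟩
  count (λ x → ⌊ x ∈? b ∷ p ⌋) (zero ∷ map Fin.suc (allFin n))
    ≡⟨ head b ⟩
  ∣ b ∷ p ∣ ∎
  where
  open ≡-Reasoning
  tail : ∀ b → count (λ x → ⌊ x ∈? b ∷ p ⌋) (map Fin.suc (allFin n)) ≡ ∣ p ∣
  tail b = begin
    count (λ x → ⌊ x ∈? b ∷ p ⌋) (map Fin.suc (allFin n))
      ≡⟨ count-map (λ x → ⌊ x ∈? b ∷ p ⌋) Fin.suc (allFin n) ⟩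
    count (λ x → ⌊ Fin.suc x ∈? b ∷ p ⌋) (allFin n)
      ≡⟨ count-cong (allFin n) (λ x → ⌊⌋-map′ there drop-there (x ∈? p)) ⟩
    count (λ x → ⌊ x ∈? p ⌋) (allFin n)
      ≡⟨ count-∈-allFin p ⟩
    ∣ p ∣ ∎
  head : ∀ b → count (λ x → ⌊ x ∈? b ∷ p ⌋) (zero ∷ map Fin.suc (allFin n)) ≡ ∣ b ∷ p ∣
  head inside  = cong suc (tail inside)
  head outside = tail outside

-- ⌊_⌋ gets stuck on the Dec.map′ in the recursive cases of ≡-dec and _⊆?_, while does computes
-- through it; so the recursions below count with does and convert by isYes≗does.
#-=ˢ : ∀ {n} (S : Subset n) → # (_=ˢ S) ≡ 1
#-=ˢ S = trans (count-cong (allSubsets _) (λ T → isYes≗does (≡-dec Bool._≟_ T S))) (#-≡ S)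
  where
  #-≡ : ∀ {n} (S : Subset n) → # (λ T → does (≡-dec Bool._≟_ T S)) ≡ 1
  #-≡ [] = refl
  #-≡ {suc n} (outside ∷ S) =
    trans (#-∷ (λ T → does (≡-dec Bool._≟_ T (outside ∷ S)))) (cong₂ _+_ (#-≡ S) (#-false n))
  #-≡ {suc n} (inside ∷ S) =
    trans (#-∷ (λ T → does (≡-dec Bool._≟_ T (inside ∷ S)))) (cong₂ _+_ (#-false n) (#-≡ S))

#-⊆ : ∀ {n} (B : Subset n) → # (λ A → ⌊ A ⊆? B ⌋) ≡ 2 ^ ∣ B ∣
#-⊆ B = trans (count-cong (allSubsets _) (λ A → isYes≗does (A ⊆? B))) (#-does-⊆ B)
  where
  #-does-⊆ : ∀ {n} (B : Subset n) → # (λ A → does (A ⊆? B)) ≡ 2 ^ ∣ B ∣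
  #-does-⊆ [] = refl
  #-does-⊆ {suc n} (outside ∷ B) = trans (#-∷ (λ A → does (A ⊆? outside ∷ B)))
    (trans (cong₂ _+_ (#-does-⊆ B) (#-false n)) (+-identityʳ _))
  #-does-⊆ {suc n} (inside ∷ B) = trans (#-∷ (λ A → does (A ⊆? inside ∷ B)))
    (trans (cong₂ _+_ (#-does-⊆ B) (#-does-⊆ B)) (cong (2 ^ ∣ B ∣ +_) (sym (+-identityʳ _))))

#-nonempty-⊆ : ∀ {n} (B : Subset n) → # (λ A → ⌊ A ⊆? B ⌋ ∧ (1 ≤ᵇ ∣ A ∣)) ≡ 2 ^ ∣ B ∣ ∸ 1
#-nonempty-⊆ B =
  trans (count-cong (allSubsets _) (λ A → cong (_∧ (1 ≤ᵇ ∣ A ∣)) (isYes≗does (A ⊆? B)))) (#-does B)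
  where
  x∸1+x : ∀ x → 1 ≤ x → x ∸ 1 + x ≡ x + (x + 0) ∸ 1
  x∸1+x (suc x) _ = cong (x +_) (sym (+-identityʳ (suc x)))
  #-does : ∀ {n} (B : Subset n) → # (λ A → does (A ⊆? B) ∧ (1 ≤ᵇ ∣ A ∣)) ≡ 2 ^ ∣ B ∣ ∸ 1
  #-does [] = refl
  #-does {suc n} (outside ∷ B) = trans (#-∷ (λ A → does (A ⊆? outside ∷ B) ∧ (1 ≤ᵇ ∣ A ∣)))
    (trans (cong₂ _+_ (#-does B) (#-false n)) (+-identityʳ _))
  #-does {suc n} (inside ∷ B) = begin
    # (λ A → does (A ⊆? inside ∷ B) ∧ (1 ≤ᵇ ∣ A ∣))
      ≡⟨ #-∷ (λ A → does (A ⊆? inside ∷ B) ∧ (1 ≤ᵇ ∣ A ∣)) ⟩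
    # (λ A → does (A ⊆? B) ∧ (1 ≤ᵇ ∣ A ∣)) + # (λ A → does (A ⊆? B) ∧ true)
      ≡⟨ cong₂ _+_ (#-does B) (count-cong (allSubsets _) (λ A → ∧-identityʳ (does (A ⊆? B)))) ⟩
    2 ^ ∣ B ∣ ∸ 1 + # (λ A → does (A ⊆? B))
      ≡⟨ cong (2 ^ ∣ B ∣ ∸ 1 +_) (trans (sym (count-cong (allSubsets _) (λ A → isYes≗does (A ⊆? B)))) (#-⊆ B)) ⟩
    2 ^ ∣ B ∣ ∸ 1 + 2 ^ ∣ B ∣
      ≡⟨ x∸1+x (2 ^ ∣ B ∣) (m^n>0 2 ∣ B ∣) ⟩
    2 ^ suc ∣ B ∣ ∸ 1 ∎
    where open ≡-Reasoning

#-size : ∀ n i → # (λ (S : Subset n) → ∣ S ∣ ≡ᵇ i) ≡ n C i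
#-size zero    zero    = refl
#-size zero    (suc i) = refl
#-size (suc n) zero    =
  trans (#-∷ (λ (S : Subset (suc n)) → ∣ S ∣ ≡ᵇ 0)) (cong₂ _+_ (#-size n 0) (#-false n))
#-size (suc n) (suc i) = begin
  # (λ (S : Subset (suc n)) → ∣ S ∣ ≡ᵇ suc i)
    ≡⟨ #-∷ (λ (S : Subset (suc n)) → ∣ S ∣ ≡ᵇ suc i) ⟩
  # (λ (S : Subset n) → ∣ S ∣ ≡ᵇ suc i) + # (λ (S : Subset n) → ∣ S ∣ ≡ᵇ i)
    ≡⟨ cong₂ _+_ (#-size n (suc i)) (#-size n i) ⟩
  n C suc i + n C i
    ≡⟨ +-comm (n C suc i) (n C i) ⟩
  n C i + n C suc i
    ≡⟨ nCk+nC[k+1]≡[n+1]C[k+1] n i ⟩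
  suc n C suc i ∎
  where open ≡-Reasoning

#-size≤ : ∀ n m → # (λ (S : Subset n) → ∣ S ∣ ≤ᵇ m) ≤ sum (map (n C_) (upTo (suc m)))
#-size≤ n m = begin
  # (λ (S : Subset n) → ∣ S ∣ ≤ᵇ m)
    ≤⟨ count-cover-sum (λ i S → ∣ S ∣ ≡ᵇ i) (upTo (suc m)) (allSubsets n) has-size ⟩
  sum (map (λ i → # (λ (S : Subset n) → ∣ S ∣ ≡ᵇ i)) (upTo (suc m)))
    ≡⟨ cong sum (map-cong (#-size n) (upTo (suc m))) ⟩
  sum (map (n C_) (upTo (suc m))) ∎
  where
  open ≤-Reasoning
  has-size : ∀ S → T (∣ S ∣ ≤ᵇ m) → Any (λ i → T (∣ S ∣ ≡ᵇ i)) (upTo (suc m))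
  has-size S ≤m = lose (∈-upTo⁺ (s≤s (≤ᵇ⇒≤ _ m ≤m))) (≡⇒≡ᵇ ∣ S ∣ ∣ S ∣ refl)

x∈p⇒⁅x⁆⊆p : ∀ {n} {x : Fin n} {p : Subset n} → x ∈ p → ⁅ x ⁆ ⊆ p
x∈p⇒⁅x⁆⊆p {x = x} {p} x∈p y∈⁅x⁆ = subst (_∈ p) (sym (x∈⁅y⁆⇒x≡y x y∈⁅x⁆)) x∈p

module _ {n : ℕ} where

  Nonempty⇒1≤∣p∣ : {p : Subset n} → Nonempty p → 1 ≤ ∣ p ∣
  Nonempty⇒1≤∣p∣ (x , x∈p) = subst (_≤ _) (∣⁅x⁆∣≡1 x) (p⊆q⇒∣p∣≤∣q∣ (x∈p⇒⁅x⁆⊆p x∈p))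

  Nonempty-∩-comm : {p q : Subset n} → Nonempty (p ∩ q) → Nonempty (q ∩ p)
  Nonempty-∩-comm {p} {q} (x , x∈p∩q) with x∈p , x∈q ← x∈p∩q⁻ p q x∈p∩q = x , x∈p∩q⁺ (x∈q , x∈p)

  ∪-⊆ : {p q r : Subset n} → p ⊆ r → q ⊆ r → p ∪ q ⊆ r
  ∪-⊆ {p} {q} p⊆r q⊆r x∈p∪q with x∈p∪q⁻ p q x∈p∪q
  ... | inj₁ x∈p = p⊆r x∈p
  ... | inj₂ x∈q = q⊆r x∈q

  ⊆⇒⊂⊎≡ : {p q : Subset n} → p ⊆ q → p ⊂ q ⊎ p ≡ q
  ⊆⇒⊂⊎≡ {p} {q} p⊆q with any? (λ x → x ∈? q ×-dec ¬? (x ∈? p))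
  ... | yes (x , x∈q , x∉p) = inj₁ (p⊆q , x , x∈q , x∉p)
  ... | no  ∄ = inj₂ (⊆-antisym p⊆q (λ {x} x∈q → decidable-stable (x ∈? p) (λ x∉p → ∄ (x , x∈q , x∉p))))

  ⊆∧∣q∣≤∣p∣⇒≡ : {p q : Subset n} → p ⊆ q → ∣ q ∣ ≤ ∣ p ∣ → p ≡ q
  ⊆∧∣q∣≤∣p∣⇒≡ p⊆q ∣q∣≤∣p∣ with ⊆⇒⊂⊎≡ p⊆q
  ... | inj₁ p⊂q = contradiction ∣q∣≤∣p∣ (<⇒≱ (p⊂q⇒∣p∣<∣q∣ p⊂q))
  ... | inj₂ p≡q = p≡q

  ⊆∧∣p∣<∣q∣⇒⊂ : {p q : Subset n} → p ⊆ q → ∣ p ∣ < ∣ q ∣ → p ⊂ q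
  ⊆∧∣p∣<∣q∣⇒⊂ p⊆q ∣p∣<∣q∣ with ⊆⇒⊂⊎≡ p⊆q
  ... | inj₁ p⊂q  = p⊂q
  ... | inj₂ refl = contradiction ∣p∣<∣q∣ (<-irrefl refl)

1≤∣p∣⇒Nonempty : ∀ {n} {p : Subset n} → 1 ≤ ∣ p ∣ → Nonempty p
1≤∣p∣⇒Nonempty {p = inside  ∷ p} _ = zero , here
1≤∣p∣⇒Nonempty {p = outside ∷ p} 1≤∣p∣ with x , x∈p ← 1≤∣p∣⇒Nonempty 1≤∣p∣ = suc x , there x∈p

∣p∣<n⇒∃∉ : ∀ {n} (p : Subset n) → ∣ p ∣ < n → ∃ λ x → x ∉ p
∣p∣<n⇒∃∉ (outside ∷ p) _ = zero , λ ()
∣p∣<n⇒∃∉ (inside  ∷ p) (s≤s ∣p∣<n) with x , x∉p ← ∣p∣<n⇒∃∉ p ∣p∣<n = suc x , x∉p ∘ drop-there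

∣p∪q∣≡∣p∣+∣q∣ : ∀ {n} (p q : Subset n) → Empty (p ∩ q) → ∣ p ∪ q ∣ ≡ ∣ p ∣ + ∣ q ∣
∣p∪q∣≡∣p∣+∣q∣ []            []            _     = refl
∣p∪q∣≡∣p∣+∣q∣ (inside  ∷ p) (inside  ∷ q) p∩q=∅ = contradiction (zero , here) p∩q=∅
∣p∪q∣≡∣p∣+∣q∣ (inside  ∷ p) (outside ∷ q) p∩q=∅ = cong suc (∣p∪q∣≡∣p∣+∣q∣ p q (drop-∷-Empty p∩q=∅))
∣p∪q∣≡∣p∣+∣q∣ (outside ∷ p) (inside  ∷ q) p∩q=∅ =
  trans (cong suc (∣p∪q∣≡∣p∣+∣q∣ p q (drop-∷-Empty p∩q=∅))) (sym (+-suc ∣ p ∣ ∣ q ∣))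
∣p∪q∣≡∣p∣+∣q∣ (outside ∷ p) (outside ∷ q) p∩q=∅ = ∣p∪q∣≡∣p∣+∣q∣ p q (drop-∷-Empty p∩q=∅)

∣p─q∣+∣q∣≡∣p∪q∣ : ∀ {n} (p q : Subset n) → ∣ p ─ q ∣ + ∣ q ∣ ≡ ∣ p ∪ q ∣
∣p─q∣+∣q∣≡∣p∪q∣ []            []            = refl
∣p─q∣+∣q∣≡∣p∪q∣ (inside  ∷ p) (inside  ∷ q) = trans (+-suc _ _) (cong suc (∣p─q∣+∣q∣≡∣p∪q∣ p q))
∣p─q∣+∣q∣≡∣p∪q∣ (outside ∷ p) (inside  ∷ q) = trans (+-suc _ _) (cong suc (∣p─q∣+∣q∣≡∣p∪q∣ p q))
∣p─q∣+∣q∣≡∣p∪q∣ (inside  ∷ p) (outside ∷ q) = cong suc (∣p─q∣+∣q∣≡∣p∪q∣ p q)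
∣p─q∣+∣q∣≡∣p∪q∣ (outside ∷ p) (outside ∷ q) = ∣p─q∣+∣q∣≡∣p∪q∣ p q

∣p─q∣≤∣r∣∸∣q∣ : ∀ {n} {p q r : Subset n} → p ⊆ r → q ⊆ r → ∣ p ─ q ∣ ≤ ∣ r ∣ ∸ ∣ q ∣
∣p─q∣≤∣r∣∸∣q∣ {p = p} {q} {r} p⊆r q⊆r = m+n≤o⇒m≤o∸n ∣ p ─ q ∣ (begin
  ∣ p ─ q ∣ + ∣ q ∣ ≡⟨ ∣p─q∣+∣q∣≡∣p∪q∣ p q ⟩
  ∣ p ∪ q ∣         ≤⟨ p⊆q⇒∣p∣≤∣q∣ (∪-⊆ p⊆r q⊆r) ⟩
  ∣ r ∣             ∎)
  where open ≤-Reasoning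

∣p∪⁅x⁆∣≡1+∣p∣ : ∀ {n} (p : Subset n) {x} → x ∉ p → ∣ p ∪ ⁅ x ⁆ ∣ ≡ suc ∣ p ∣
∣p∪⁅x⁆∣≡1+∣p∣ p {x} x∉p = begin
  ∣ p ∪ ⁅ x ⁆ ∣     ≡⟨ ∣p∪q∣≡∣p∣+∣q∣ p ⁅ x ⁆ disjoint ⟩
  ∣ p ∣ + ∣ ⁅ x ⁆ ∣ ≡⟨ cong (∣ p ∣ +_) (∣⁅x⁆∣≡1 x) ⟩
  ∣ p ∣ + 1         ≡⟨ +-comm ∣ p ∣ 1 ⟩
  suc ∣ p ∣         ∎
  where
  open ≡-Reasoning
  disjoint : Empty (p ∩ ⁅ x ⁆)
  disjoint (y , y∈p∩⁅x⁆) with y∈p , y∈⁅x⁆ ← x∈p∩q⁻ p ⁅ x ⁆ y∈p∩⁅x⁆ =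
    x∉p (subst (_∈ p) (x∈⁅y⁆⇒x≡y x y∈⁅x⁆) y∈p)

∣⁅x⁆∪⁅y⁆∣≡2 : ∀ {n} {x y : Fin n} → y ≢ x → ∣ ⁅ x ⁆ ∪ ⁅ y ⁆ ∣ ≡ 2
∣⁅x⁆∪⁅y⁆∣≡2 {x = x} y≢x = trans (∣p∪⁅x⁆∣≡1+∣p∣ ⁅ x ⁆ (x≢y⇒x∉⁅y⁆ y≢x)) (cong suc (∣⁅x⁆∣≡1 x))

p∩q∪p─q≡p : ∀ {n} (p q : Subset n) → (p ∩ q) ∪ (p ─ q) ≡ p
p∩q∪p─q≡p []            []            = refl
p∩q∪p─q≡p (inside  ∷ p) (inside  ∷ q) = cong (inside ∷_) (p∩q∪p─q≡p p q)
p∩q∪p─q≡p (inside  ∷ p) (outside ∷ q) = cong (inside ∷_) (p∩q∪p─q≡p p q)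
p∩q∪p─q≡p (outside ∷ p) (inside  ∷ q) = cong (outside ∷_) (p∩q∪p─q≡p p q)
p∩q∪p─q≡p (outside ∷ p) (outside ∷ q) = cong (outside ∷_) (p∩q∪p─q≡p p q)

grow-avoiding : ∀ {n} (S R : Subset n) → Empty (S ∩ R) → ∣ S ∣ + ∣ R ∣ < n →
  ∃ λ x → Empty ((S ∪ ⁅ x ⁆) ∩ R) × ∣ S ∪ ⁅ x ⁆ ∣ ≡ suc ∣ S ∣
grow-avoiding S R S∩R=∅ small with ∣p∣<n⇒∃∉ (S ∪ R) (subst (_< _) (sym (∣p∪q∣≡∣p∣+∣q∣ S R S∩R=∅)) small)
... | x , x∉S∪R = x , disjoint x x∉S∪R , ∣p∪⁅x⁆∣≡1+∣p∣ S (x∉S∪R ∘ p⊆p∪q R)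
  where
  disjoint : ∀ x → x ∉ S ∪ R → Empty ((S ∪ ⁅ x ⁆) ∩ R)
  disjoint x x∉S∪R (y , y∈S'∩R) with x∈p∩q⁻ (S ∪ ⁅ x ⁆) R y∈S'∩R
  ... | y∈S' , y∈R with x∈p∪q⁻ S ⁅ x ⁆ y∈S'
  ...   | inj₁ y∈S   = S∩R=∅ (y , x∈p∩q⁺ (y∈S , y∈R))
  ...   | inj₂ y∈⁅x⁆ = x∉S∪R (q⊆p∪q S R (subst (_∈ R) (x∈⁅y⁆⇒x≡y x y∈⁅x⁆) y∈R))

extend-avoiding : ∀ {n} d (S R : Subset n) → Empty (S ∩ R) → ∣ S ∣ + d + ∣ R ∣ ≤ n →
  ∃ λ G → S ⊆ G × Empty (G ∩ R) × ∣ G ∣ ≡ ∣ S ∣ + d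
extend-avoiding zero    S R S∩R=∅ _    = S , (λ x∈S → x∈S) , S∩R=∅ , sym (+-identityʳ ∣ S ∣)
extend-avoiding {n} (suc d) S R S∩R=∅ room
  with x , S'∩R=∅ , ∣S'∣ ← grow-avoiding S R S∩R=∅ (<-≤-trans (+-monoˡ-< ∣ R ∣ (m<m+n ∣ S ∣ z<s)) room)
  with G , S'⊆G , G∩R=∅ , ∣G∣ ← extend-avoiding d (S ∪ ⁅ x ⁆) R S'∩R=∅
         (subst (λ s → s + d + ∣ R ∣ ≤ n) (sym ∣S'∣) (subst (λ s → s + ∣ R ∣ ≤ n) (+-suc ∣ S ∣ d) room))
  = G , S'⊆G ∘ p⊆p∪q ⁅ x ⁆ , G∩R=∅ , trans ∣G∣ (trans (cong (_+ d) ∣S'∣) (sym (+-suc ∣ S ∣ d)))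

T-not⇒¬T : ∀ {b} → T (not b) → ¬ T b
T-not⇒¬T {true} ()

T-not∨⁻ : ∀ {b c} → T (not b ∨ c) → T b → T c
T-not∨⁻ {true} c _ = c

T-not∨⁺ : ∀ {b c} → (T b → T c) → T (not b ∨ c)
T-not∨⁺ {true}  b⇒c = b⇒c tt
T-not∨⁺ {false} _   = tt

module _ {n : ℕ} where

  any-allSubsets⁺ : (p : Subset n → Bool) (S : Subset n) → T (p S) → T (any p (allSubsets n))
  any-allSubsets⁺ p S pS = any⁺ p (lose (∈-allSubsets S) pS)

  any-allSubsets⁻ : (p : Subset n → Bool) → T (any p (allSubsets n)) → ∃ λ S → T (p S)
  any-allSubsets⁻ p h = Any.satisfied (any⁻ p (allSubsets n) h)

  all-allSubsets⁺ : (p : Subset n → Bool) → (∀ S → T (p S)) → T (all p (allSubsets n))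
  all-allSubsets⁺ p h = all⁻ p {xs = allSubsets n} (All.tabulate (λ {S} _ → h S))

  all-allSubsets⁻ : (p : Subset n → Bool) → T (all p (allSubsets n)) → ∀ S → T (p S)
  all-allSubsets⁻ p h S = All.lookup (all⁺ p (allSubsets n) h) (∈-allSubsets S)

  ∈𝓣⁺ : ∀ {k} {𝓖 : Family n} {S} → ∣ S ∣ ≤ k → Covers 𝓖 S → S ∈ᶠ 𝓣 k 𝓖
  ∈𝓣⁺ ≤k covers = Equivalence.from T-∧
    (≤⇒≤ᵇ ≤k , all-allSubsets⁺ _ (λ G → T-not∨⁺ (λ G∈𝓖 → fromWitness (covers G G∈𝓖))))

  ∈𝓣⁻ : ∀ {k} {𝓖 : Family n} {S} → S ∈ᶠ 𝓣 k 𝓖 → ∣ S ∣ ≤ k × Covers 𝓖 S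
  ∈𝓣⁻ {𝓖 = 𝓖} {S} S∈𝓣 with ≤k , meets-all ← Equivalence.to T-∧ S∈𝓣 =
    ≤ᵇ⇒≤ _ _ ≤k , λ G G∈𝓖 → toWitness
      (T-not∨⁻ (all-allSubsets⁻ (λ G → not (𝓖 G) ∨ ⌊ nonempty? (S ∩ G) ⌋) meets-all G) G∈𝓖)

  ∉𝓣⇒missed : ∀ {k} {𝓖 : Family n} {S} → ∣ S ∣ ≤ k → ¬ S ∈ᶠ 𝓣 k 𝓖 → ∃ λ G → G ∈ᶠ 𝓖 × Empty (S ∩ G)
  ∉𝓣⇒missed {𝓖 = 𝓖} {S} ≤k S∉𝓣 with anySubset? (λ G → T? (𝓖 G) ×-dec ¬? (nonempty? (S ∩ G)))
  ... | yes missed = missed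
  ... | no  ∄      = contradiction (∈𝓣⁺ ≤k covers) S∉𝓣
    where
    covers : Covers 𝓖 S
    covers G G∈𝓖 = decidable-stable (nonempty? (S ∩ G)) (λ S∩G=∅ → ∄ (G , G∈𝓖 , S∩G=∅))

  minimal⇒∈ : ∀ (𝓖 : Family n) {S} → S ∈ᶠ minimalᶠ 𝓖 → S ∈ᶠ 𝓖
  minimal⇒∈ 𝓖 {S} = proj₁ ∘ Equivalence.to (T-∧ {𝓖 S})

  minimal⇒⊂∉ : ∀ (𝓖 : Family n) {S P} → S ∈ᶠ minimalᶠ 𝓖 → P ⊂ S → ¬ P ∈ᶠ 𝓖
  minimal⇒⊂∉ 𝓖 {S} {P} S∈min P⊂S P∈𝓖 = T-not⇒¬T (proj₂ (Equivalence.to (T-∧ {𝓖 S}) S∈min))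
    (any-allSubsets⁺ (λ S' → 𝓖 S' ∧ ⌊ S' ⊂? S ⌋) P (Equivalence.from (T-∧ {𝓖 P}) (P∈𝓖 , fromWitness P⊂S)))

  layer⁺ : ∀ (𝓖 : Family n) {j S} → S ∈ᶠ 𝓖 → ∣ S ∣ ≡ j → S ∈ᶠ layer 𝓖 j
  layer⁺ 𝓖 {S = S} S∈𝓖 ∣S∣≡j = Equivalence.from (T-∧ {𝓖 S}) (S∈𝓖 , ≡⇒≡ᵇ _ _ ∣S∣≡j)

  layer⁻ : ∀ (𝓖 : Family n) {j S} → S ∈ᶠ layer 𝓖 j → S ∈ᶠ 𝓖 × ∣ S ∣ ≡ j
  layer⁻ 𝓖 {S = S} S∈layer with S∈𝓖 , ∣S∣≡j ← Equivalence.to (T-∧ {𝓖 S}) S∈layer =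
    S∈𝓖 , ≡ᵇ⇒≡ _ _ ∣S∣≡j

  upTo-layer⁻ : ∀ (𝓖 : Family n) {ℓ S} → S ∈ᶠ upTo-layer 𝓖 ℓ → S ∈ᶠ 𝓖 × ∣ S ∣ ≤ ℓ
  upTo-layer⁻ 𝓖 {S = S} S∈layers with S∈𝓖 , sized ← Equivalence.to (T-∧ {𝓖 S}) S∈layers =
    S∈𝓖 , ≤ᵇ⇒≤ ∣ S ∣ _ (proj₂ (Equivalence.to (T-∧ {1 ≤ᵇ ∣ S ∣}) sized))

  maxBin≡⇒∃ : ∀ (𝓖 : Family n) {F ℓ} → 1 ≤ ℓ → maxBin 𝓖 F ≡ ℓ → ∃ λ B → B ∈ᶠ 𝓖 × B ⊆ F × ∣ B ∣ ≡ ℓ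
  maxBin≡⇒∃ 𝓖 {F} 1≤ℓ max≡ℓ with foldr-selective ⊔-sel 0 (map ∣_∣ (filterᵇ below (allSubsets n)))
    where below = λ B → 𝓖 B ∧ ⌊ B ⊆? F ⌋
  ... | inj₁ max≡0 = contradiction (trans (sym max≡ℓ) max≡0) (>⇒≢ 1≤ℓ)
  ... | inj₂ max∈
    with B , B∈below , max≡∣B∣ ← ∈-map⁻ ∣_∣ max∈
    with _ , B∈𝓖⊆F ← ∈-filter⁻ (T? ∘ (λ B → 𝓖 B ∧ ⌊ B ⊆? F ⌋)) {xs = allSubsets n} B∈below
    with B∈𝓖 , B⊆F ← Equivalence.to (T-∧ {𝓖 B}) B∈𝓖⊆F
    = B , B∈𝓖 , toWitness B⊆F , trans (sym max≡∣B∣) max≡ℓ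

  ∈𝓘⁻ : ∀ {𝓕 𝓖 : Family n} {t ℓ I} → I ∈ᶠ 𝓘 𝓕 𝓖 t ℓ →
    ∃ λ F → ∃ λ F' → (F ∈ᶠ 𝓕 × maxBin 𝓖 F ≡ ℓ) × F' ∈ᶠ 𝓕 × F ∩ F' ≡ I
  ∈𝓘⁻ I∈𝓘
    with F , F∈ ← any-allSubsets⁻ _ I∈𝓘
    with F∈level , ∃F' ← Equivalence.to T-∧ F∈
    with F' , F'∈ ← any-allSubsets⁻ _ ∃F'
    with F'∈range , F∩F'≡I ← Equivalence.to T-∧ F'∈
    with F∈𝓕 , max≡ℓ ← Equivalence.to T-∧ F∈level
    = F , F' , (F∈𝓕 , ≡ᵇ⇒≡ _ _ max≡ℓ) , proj₁ (Equivalence.to T-∧ F'∈range) , toWitness F∩F'≡I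

  insertᶠ⁻ : ∀ G (𝓖 : Family n) {S} → S ∈ᶠ insertᶠ G 𝓖 → S ∈ᶠ 𝓖 ⊎ S ≡ G
  insertᶠ⁻ G 𝓖 {S} S∈ with Equivalence.to (T-∨ {𝓖 S}) S∈
  ... | inj₁ S∈𝓖 = inj₁ S∈𝓖
  ... | inj₂ S≡G = inj₂ (toWitness S≡G)

  Covers-⊆ : {𝓖 : Family n} {p q : Subset n} → p ⊆ q → Covers 𝓖 p → Covers 𝓖 q
  Covers-⊆ {p = p} p⊆q covers G G∈𝓖
    with x , x∈p∩G ← covers G G∈𝓖
    with x∈p , x∈G ← x∈p∩q⁻ p G x∈p∩G
    = x , x∈p∩q⁺ (p⊆q x∈p , x∈G)

  τ≥-weaken : {𝓖 : Family n} {m m' : ℕ} → m ≤ m' → τ≥ m' 𝓖 → τ≥ m 𝓖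
  τ≥-weaken m≤m' τ≥m' S covers = ≤-trans m≤m' (τ≥m' S covers)

  τ≥1⇒∃ : {𝓖 : Family n} → τ≥ 1 𝓖 → ∃ λ G → G ∈ᶠ 𝓖
  τ≥1⇒∃ {𝓖} τ≥1 with anySubset? (λ G → T? (𝓖 G))
  ... | yes ∃G = ∃G
  ... | no  ∄G = contradiction (subst (1 ≤_) (∣⊥∣≡0 n) (τ≥1 ⊥ (λ G G∈𝓖 → contradiction (G , G∈𝓖) ∄G))) λ ()

  τ≥2⇒avoiding : {𝓖 : Family n} → τ≥ 2 𝓖 → ∀ x → ∃ λ G → G ∈ᶠ 𝓖 × x ∉ G
  τ≥2⇒avoiding {𝓖} τ≥2 x with anySubset? (λ G → T? (𝓖 G) ×-dec ¬? (x ∈? G))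
  ... | yes found = found
  ... | no  ∄     = contradiction (subst (2 ≤_) (∣⁅x⁆∣≡1 x) (τ≥2 ⁅ x ⁆ covers)) λ { (s≤s ()) }
    where
    covers : Covers 𝓖 ⁅ x ⁆
    covers G G∈𝓖 = x , x∈p∩q⁺ (x∈⁅x⁆ x , decidable-stable (x ∈? G) (λ x∉G → ∄ (G , G∈𝓖 , x∉G)))

  upTo-layer-intersecting : {𝓖 : Family n} {ℓ : ℕ} → Intersecting 𝓖 → Intersecting (upTo-layer 𝓖 ℓ)
  upTo-layer-intersecting {𝓖} intersecting A B A∈ B∈ =
    intersecting A B (proj₁ (upTo-layer⁻ 𝓖 {S = A} A∈)) (proj₁ (upTo-layer⁻ 𝓖 {S = B} B∈))

  intersecting∧τ≥2⇒2≤∣G∣ : {𝓖 : Family n} → Intersecting 𝓖 → τ≥ 2 𝓖 → ∀ {G} → G ∈ᶠ 𝓖 → 2 ≤ ∣ G ∣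
  intersecting∧τ≥2⇒2≤∣G∣ intersecting τ≥2 {G} G∈𝓖
    with x , x∈G∩G        ← intersecting G G G∈𝓖 G∈𝓖
    with G' , G'∈𝓖 , x∉G' ← τ≥2⇒avoiding τ≥2 x
    with y , y∈G∩G'       ← intersecting G G' G∈𝓖 G'∈𝓖
    with y∈G , y∈G'       ← x∈p∩q⁻ G G' y∈G∩G'
    = subst (_≤ ∣ G ∣) (∣⁅x⁆∪⁅y⁆∣≡2 (λ y≡x → x∉G' (subst (_∈ G') y≡x y∈G')))
        (p⊆q⇒∣p∣≤∣q∣ (∪-⊆ (x∈p⇒⁅x⁆⊆p (proj₁ (x∈p∩q⁻ G G x∈G∩G))) (x∈p⇒⁅x⁆⊆p y∈G)))

  τ≥2⇒2≤ℓ : {𝓖 : Family n} {ℓ : ℕ} → Intersecting 𝓖 → τ≥ 2 (upTo-layer 𝓖 ℓ) → 2 ≤ ℓ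
  τ≥2⇒2≤ℓ {𝓖} intersecting τ≥2 with G , G∈ ← τ≥1⇒∃ (τ≥-weaken (s≤s z≤n) τ≥2) =
    ≤-trans (intersecting∧τ≥2⇒2≤∣G∣ (upTo-layer-intersecting intersecting) τ≥2 G∈)
            (proj₂ (upTo-layer⁻ 𝓖 {S = G} G∈))

∈𝓑⁻ : ∀ {n} k (𝓕 : Family n) {B} → B ∈ᶠ 𝓑 k 𝓕 → ∣ B ∣ ≤ k × Covers 𝓕 B
∈𝓑⁻ k 𝓕 {B} B∈𝓑 = ∈𝓣⁻ {k = k} {𝓖 = 𝓕} {S = B} (minimal⇒∈ (𝓣 k 𝓕) B∈𝓑)

saturated⇒covering-∈ : ∀ {n k} {𝓕 : Family n} {G} →
  Saturated k 𝓕 → 1 ≤ k → ∣ G ∣ ≡ k → Covers 𝓕 G → G ∈ᶠ 𝓕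
saturated⇒covering-∈ {𝓕 = 𝓕} {G} (intersecting , maximal) 1≤k ∣G∣≡k covers with T? (𝓕 G)
... | yes G∈𝓕 = G∈𝓕
... | no  G∉𝓕 = contradiction still-intersecting (maximal G ∣G∣≡k G∉𝓕)
  where
  still-intersecting : Intersecting (insertᶠ G 𝓕)
  still-intersecting S₁ S₂ S₁∈ S₂∈ with insertᶠ⁻ G 𝓕 S₁∈ | insertᶠ⁻ G 𝓕 S₂∈
  ... | inj₁ S₁∈𝓕 | inj₁ S₂∈𝓕 = intersecting S₁ S₂ S₁∈𝓕 S₂∈𝓕
  ... | inj₁ S₁∈𝓕 | inj₂ refl  = Nonempty-∩-comm (covers S₁ S₁∈𝓕)
  ... | inj₂ refl  | inj₁ S₂∈𝓕 = covers S₂ S₂∈𝓕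
  ... | inj₂ refl  | inj₂ refl  with x , x∈G ← 1≤∣p∣⇒Nonempty (subst (1 ≤_) (sym ∣G∣≡k) 1≤k) =
    x , x∈p∩q⁺ (x∈G , x∈G)

𝓑-intersecting : ∀ {n k} {𝓕 : Family n} → 2 * k < n → 1 ≤ k → Saturated k 𝓕 → Intersecting (𝓑 k 𝓕)
𝓑-intersecting {n} {k} {𝓕} 2k<n 1≤k saturated B₁ B₂ B₁∈𝓑 B₂∈𝓑 with nonempty? (B₁ ∩ B₂)
... | yes B₁∩B₂≠∅ = B₁∩B₂≠∅
... | no  B₁∩B₂=∅ = contradiction (extend-avoiding (k ∸ ∣ B₁ ∣) B₁ B₂ B₁∩B₂=∅ room) no-extension
  where
  ∣B₁∣≤k = proj₁ (∈𝓑⁻ k 𝓕 B₁∈𝓑)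
  ∣B₂∣≤k = proj₁ (∈𝓑⁻ k 𝓕 B₂∈𝓑)
  room : ∣ B₁ ∣ + (k ∸ ∣ B₁ ∣) + ∣ B₂ ∣ ≤ n
  room = begin
    ∣ B₁ ∣ + (k ∸ ∣ B₁ ∣) + ∣ B₂ ∣ ≡⟨ cong (_+ ∣ B₂ ∣) (m+[n∸m]≡n ∣B₁∣≤k) ⟩
    k + ∣ B₂ ∣                     ≤⟨ +-monoʳ-≤ k ∣B₂∣≤k ⟩
    k + k                          ≡⟨ cong (k +_) (sym (+-identityʳ k)) ⟩
    2 * k                          <⟨ 2k<n ⟩
    n                              ∎
    where open ≤-Reasoning
  no-extension : ¬ (∃ λ G → B₁ ⊆ G × Empty (G ∩ B₂) × ∣ G ∣ ≡ ∣ B₁ ∣ + (k ∸ ∣ B₁ ∣))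
  no-extension (G , B₁⊆G , G∩B₂=∅ , ∣G∣) = G∩B₂=∅ (Nonempty-∩-comm (proj₂ (∈𝓑⁻ k 𝓕 B₂∈𝓑) G G∈𝓕))
    where
    G∈𝓕 : G ∈ᶠ 𝓕
    G∈𝓕 = saturated⇒covering-∈ saturated 1≤k (trans ∣G∣ (m+[n∸m]≡n ∣B₁∣≤k))
            (Covers-⊆ B₁⊆G (proj₂ (∈𝓑⁻ k 𝓕 B₁∈𝓑)))

containing : ∀ {n} → Family n → Subset n → Family n
containing 𝓛 P B = 𝓛 B ∧ ⌊ P ⊆? B ⌋

module _ {n : ℕ} (𝓛 : Family n) where

  containing⁺ : ∀ {P B} → B ∈ᶠ 𝓛 → P ⊆ B → B ∈ᶠ containing 𝓛 P
  containing⁺ {P} {B} B∈𝓛 P⊆B =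
    Equivalence.from (T-∧ {𝓛 B}) (B∈𝓛 , fromWitness {a? = P ⊆? B} (λ {x} → P⊆B {x}))

  containing⁻ : ∀ {P B} → B ∈ᶠ containing 𝓛 P → B ∈ᶠ 𝓛 × P ⊆ B
  containing⁻ {P} {B} B∈ with B∈𝓛 , P⊆B ← Equivalence.to (T-∧ {𝓛 B}) B∈ = B∈𝓛 , toWitness P⊆B

  #containing-branch : (P G : Subset n) {c : ℕ} →
    (∀ B → B ∈ᶠ 𝓛 → P ⊆ B → Nonempty (B ∩ G)) →
    (∀ z → z ∈ G → # (containing 𝓛 (P ∪ ⁅ z ⁆)) ≤ c) →
    # (containing 𝓛 P) ≤ ∣ G ∣ * c
  #containing-branch P G {c} meets bound = begin
    # (containing 𝓛 P)
      ≤⟨ count-cover (λ z → ⌊ z ∈? G ⌋) (λ z → containing 𝓛 (P ∪ ⁅ z ⁆)) (allFin n) (allSubsets n)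
                     cover (λ z z∈G → bound z (toWitness z∈G)) ⟩
    count (λ z → ⌊ z ∈? G ⌋) (allFin n) * c
      ≡⟨ cong (_* c) (count-∈-allFin G) ⟩
    ∣ G ∣ * c ∎
    where
    open ≤-Reasoning
    cover : ∀ B → B ∈ᶠ containing 𝓛 P →
      Any (λ z → T ⌊ z ∈? G ⌋ × B ∈ᶠ containing 𝓛 (P ∪ ⁅ z ⁆)) (allFin n)
    cover B B∈
      with B∈𝓛 , P⊆B ← containing⁻ B∈
      with z , z∈B∩G ← meets B B∈𝓛 P⊆B
      with z∈B , z∈G ← x∈p∩q⁻ B G z∈B∩G
      = lose (∈-allFin z) (fromWitness z∈G , containing⁺ B∈𝓛 (∪-⊆ P⊆B (x∈p⇒⁅x⁆⊆p z∈B)))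

module _ {n k : ℕ} {𝓕 : Family n} (uniform : IsUniform k 𝓕) {ℓ : ℕ} (ℓ≤k : ℓ ≤ k) where

  #containing≤ : ∀ d P → d + ∣ P ∣ ≡ ℓ → # (containing (layer (𝓑 k 𝓕) ℓ) P) ≤ k ^ d
  #containing≤ zero P ∣P∣≡ℓ = begin
    # (containing (layer (𝓑 k 𝓕) ℓ) P) ≤⟨ count-mono (allSubsets n) (λ B B∈ → fromWitness (sym (only-P B B∈))) ⟩
    # (_=ˢ P)                           ≡⟨ #-=ˢ P ⟩
    1                                   ∎
    where
    open ≤-Reasoning
    only-P : ∀ B → B ∈ᶠ containing (layer (𝓑 k 𝓕) ℓ) P → P ≡ B
    only-P B B∈ with B∈layer , P⊆B ← containing⁻ (layer (𝓑 k 𝓕) ℓ) B∈ =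
      ⊆∧∣q∣≤∣p∣⇒≡ P⊆B (≤-reflexive (trans (proj₂ (layer⁻ (𝓑 k 𝓕) {S = B} B∈layer)) (sym ∣P∣≡ℓ)))
  #containing≤ (suc d) P ∣P∣≡ℓ with T? (𝓣 k 𝓕 P)
  ... | yes P∈𝓣 = ≤-trans (≤-reflexive (count-none (allSubsets n) no-member-above)) z≤n
    where
    no-member-above : ∀ B → ¬ B ∈ᶠ containing (layer (𝓑 k 𝓕) ℓ) P
    no-member-above B B∈
      with B∈layer , P⊆B ← containing⁻ (layer (𝓑 k 𝓕) ℓ) B∈
      with B∈𝓑 , ∣B∣≡ℓ ← layer⁻ (𝓑 k 𝓕) {S = B} B∈layer
      = minimal⇒⊂∉ (𝓣 k 𝓕) B∈𝓑
          (⊆∧∣p∣<∣q∣⇒⊂ P⊆B (subst (∣ P ∣ <_) (trans ∣P∣≡ℓ (sym ∣B∣≡ℓ)) (m<n+m ∣ P ∣ z<s))) P∈𝓣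
  ... | no  P∉𝓣 = through-missed-set (∉𝓣⇒missed ∣P∣≤k P∉𝓣)
    where
    ∣P∣≤k : ∣ P ∣ ≤ k
    ∣P∣≤k = ≤-trans (m≤n+m ∣ P ∣ (suc d)) (≤-trans (≤-reflexive ∣P∣≡ℓ) ℓ≤k)
    through-missed-set : (∃ λ F → F ∈ᶠ 𝓕 × Empty (P ∩ F)) → # (containing (layer (𝓑 k 𝓕) ℓ) P) ≤ k ^ suc d
    through-missed-set (F , F∈𝓕 , P∩F=∅) = begin
      # (containing (layer (𝓑 k 𝓕) ℓ) P) ≤⟨ #containing-branch (layer (𝓑 k 𝓕) ℓ) P F meets-F bound ⟩
      ∣ F ∣ * k ^ d                       ≡⟨ cong (_* k ^ d) (uniform F F∈𝓕) ⟩
      k ^ suc d                           ∎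
      where
      open ≤-Reasoning
      meets-F : ∀ B → B ∈ᶠ layer (𝓑 k 𝓕) ℓ → P ⊆ B → Nonempty (B ∩ F)
      meets-F B B∈layer _ = proj₂ (∈𝓑⁻ k 𝓕 (proj₁ (layer⁻ (𝓑 k 𝓕) B∈layer))) F F∈𝓕
      bound : ∀ z → z ∈ F → # (containing (layer (𝓑 k 𝓕) ℓ) (P ∪ ⁅ z ⁆)) ≤ k ^ d
      bound z z∈F = #containing≤ d (P ∪ ⁅ z ⁆) (begin-equality
        d + ∣ P ∪ ⁅ z ⁆ ∣ ≡⟨ cong (d +_) (∣p∪⁅x⁆∣≡1+∣p∣ P (λ z∈P → P∩F=∅ (z , x∈p∩q⁺ (z∈P , z∈F)))) ⟩
        d + suc ∣ P ∣     ≡⟨ +-suc d ∣ P ∣ ⟩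
        suc d + ∣ P ∣     ≡⟨ ∣P∣≡ℓ ⟩
        ℓ                 ∎)

  #layer≤ : Intersecting (𝓑 k 𝓕) → τ≥ 2 (upTo-layer (𝓑 k 𝓕) ℓ) → 2 ≤ ℓ →
    # (layer (𝓑 k 𝓕) ℓ) ≤ ℓ ^ 2 * k ^ (ℓ ∸ 2)
  #layer≤ intersecting τ≥2 2≤ℓ = through-member (τ≥1⇒∃ (τ≥-weaken (s≤s z≤n) τ≥2))
    where
    meets : ∀ {G} → G ∈ᶠ upTo-layer (𝓑 k 𝓕) ℓ → ∀ {P} B → B ∈ᶠ layer (𝓑 k 𝓕) ℓ → P ⊆ B → Nonempty (B ∩ G)
    meets {G} G∈ B B∈layer _ =
      intersecting B G (proj₁ (layer⁻ (𝓑 k 𝓕) B∈layer)) (proj₁ (upTo-layer⁻ (𝓑 k 𝓕) {S = G} G∈))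
    through-point : ∀ x → # (containing (layer (𝓑 k 𝓕) ℓ) ⁅ x ⁆) ≤ ℓ * k ^ (ℓ ∸ 2)
    through-point x with G₂ , G₂∈ , x∉G₂ ← τ≥2⇒avoiding τ≥2 x =
      ≤-trans (#containing-branch (layer (𝓑 k 𝓕) ℓ) ⁅ x ⁆ G₂ (meets G₂∈) bound)
              (*-monoˡ-≤ _ (proj₂ (upTo-layer⁻ (𝓑 k 𝓕) {S = G₂} G₂∈)))
      where
      bound : ∀ y → y ∈ G₂ → # (containing (layer (𝓑 k 𝓕) ℓ) (⁅ x ⁆ ∪ ⁅ y ⁆)) ≤ k ^ (ℓ ∸ 2)
      bound y y∈G₂ = #containing≤ (ℓ ∸ 2) (⁅ x ⁆ ∪ ⁅ y ⁆)
        (trans (cong (ℓ ∸ 2 +_) (∣⁅x⁆∪⁅y⁆∣≡2 (λ y≡x → x∉G₂ (subst (_∈ G₂) y≡x y∈G₂)))) (m∸n+n≡m 2≤ℓ))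
    through-member : (∃ λ G → G ∈ᶠ upTo-layer (𝓑 k 𝓕) ℓ) → # (layer (𝓑 k 𝓕) ℓ) ≤ ℓ ^ 2 * k ^ (ℓ ∸ 2)
    through-member (G₁ , G₁∈) = begin
      # (layer (𝓑 k 𝓕) ℓ)
        ≤⟨ count-mono (allSubsets n) (λ B B∈ → containing⁺ (layer (𝓑 k 𝓕) ℓ) B∈ ⊥⊆) ⟩
      # (containing (layer (𝓑 k 𝓕) ℓ) ⊥)
        ≤⟨ #containing-branch (layer (𝓑 k 𝓕) ℓ) ⊥ G₁ (meets G₁∈) bound ⟩
      ∣ G₁ ∣ * (ℓ * k ^ (ℓ ∸ 2))
        ≤⟨ *-monoˡ-≤ _ (proj₂ (upTo-layer⁻ (𝓑 k 𝓕) {S = G₁} G₁∈)) ⟩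
      ℓ * (ℓ * k ^ (ℓ ∸ 2))
        ≡⟨ sym (*-assoc ℓ ℓ _) ⟩
      ℓ * ℓ * k ^ (ℓ ∸ 2)
        ≡⟨ cong (λ m → ℓ * m * k ^ (ℓ ∸ 2)) (sym (*-identityʳ ℓ)) ⟩
      ℓ ^ 2 * k ^ (ℓ ∸ 2) ∎
      where
      open ≤-Reasoning
      bound : ∀ x → x ∈ G₁ → # (containing (layer (𝓑 k 𝓕) ℓ) (⊥ ∪ ⁅ x ⁆)) ≤ ℓ * k ^ (ℓ ∸ 2)
      bound x _ =
        subst (λ P → # (containing (layer (𝓑 k 𝓕) ℓ) P) ≤ _) (sym (∪-identityˡ ⁅ x ⁆)) (through-point x)

-- I is recovered as (I ∩ B) ∪ (I ─ B), so it is counted by a nonempty subset of B and a set of size ≤ m.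
#traced≤ : ∀ {n} (𝓛 𝓙 : Family n) (j m : ℕ) → (∀ B → B ∈ᶠ 𝓛 → ∣ B ∣ ≡ j) →
  (∀ I → I ∈ᶠ 𝓙 → ∃ λ B → B ∈ᶠ 𝓛 × Nonempty (I ∩ B) × ∣ I ─ B ∣ ≤ m) →
  # 𝓙 ≤ # 𝓛 * ((2 ^ j ∸ 1) * sum (map (n C_) (upTo (suc m))))
#traced≤ {n} 𝓛 𝓙 j m ∣B∣≡j traced = count-cover 𝓛 split-by (allSubsets n) (allSubsets n) cover bound-split
  where
  nonempty-⊆ : Subset n → Subset n → Bool
  nonempty-⊆ B A = ⌊ A ⊆? B ⌋ ∧ (1 ≤ᵇ ∣ A ∣)
  joins : Subset n → Subset n → Bool
  joins A I = any (λ C → (∣ C ∣ ≤ᵇ m) ∧ (I =ˢ (A ∪ C))) (allSubsets n)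
  split-by : Subset n → Subset n → Bool
  split-by B I = any (λ A → nonempty-⊆ B A ∧ joins A I) (allSubsets n)

  bound-joins : ∀ A → # (joins A) ≤ sum (map (n C_) (upTo (suc m)))
  bound-joins A = begin
    # (joins A)
      ≤⟨ count-any-∧ (λ C → ∣ C ∣ ≤ᵇ m) (λ C I → I =ˢ (A ∪ C)) (allSubsets n) (allSubsets n)
                     (λ C _ → ≤-reflexive (#-=ˢ (A ∪ C))) ⟩
    # (λ (C : Subset n) → ∣ C ∣ ≤ᵇ m) * 1
      ≡⟨ *-identityʳ _ ⟩
    # (λ (C : Subset n) → ∣ C ∣ ≤ᵇ m)
      ≤⟨ #-size≤ n m ⟩
    sum (map (n C_) (upTo (suc m))) ∎
    where open ≤-Reasoning

  bound-split : ∀ B → B ∈ᶠ 𝓛 → # (split-by B) ≤ (2 ^ j ∸ 1) * sum (map (n C_) (upTo (suc m)))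
  bound-split B B∈𝓛 = begin
    # (split-by B)
      ≤⟨ count-any-∧ (nonempty-⊆ B) joins (allSubsets n) (allSubsets n) (λ A _ → bound-joins A) ⟩
    # (nonempty-⊆ B) * sum (map (n C_) (upTo (suc m)))
      ≡⟨ cong (_* _) (trans (#-nonempty-⊆ B) (cong (λ b → 2 ^ b ∸ 1) (∣B∣≡j B B∈𝓛))) ⟩
    (2 ^ j ∸ 1) * sum (map (n C_) (upTo (suc m))) ∎
    where open ≤-Reasoning

  cover : ∀ I → I ∈ᶠ 𝓙 → Any (λ B → B ∈ᶠ 𝓛 × T (split-by B I)) (allSubsets n)
  cover I I∈𝓙 with B , B∈𝓛 , I∩B≠∅ , ∣I─B∣≤m ← traced I I∈𝓙 =
    lose (∈-allSubsets B) (B∈𝓛 , any-allSubsets⁺ _ (I ∩ B) (Equivalence.from T-∧ (trace-ok , excess-ok)))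
    where
    trace-ok : T (nonempty-⊆ B (I ∩ B))
    trace-ok = Equivalence.from T-∧
      (fromWitness {a? = I ∩ B ⊆? B} (λ {x} → p∩q⊆q I B {x}) , ≤⇒≤ᵇ (Nonempty⇒1≤∣p∣ I∩B≠∅))
    excess-ok : T (joins (I ∩ B) I)
    excess-ok = any-allSubsets⁺ _ (I ─ B)
      (Equivalence.from T-∧ (≤⇒≤ᵇ ∣I─B∣≤m , fromWitness (sym (p∩q∪p─q≡p I B))))

𝓘-traced : ∀ {n k} {𝓕 : Family n} → IsUniform k 𝓕 → ∀ {t ℓ I} → 1 ≤ ℓ → I ∈ᶠ 𝓘 𝓕 (𝓑 k 𝓕) t ℓ →
  ∃ λ B → B ∈ᶠ layer (𝓑 k 𝓕) ℓ × Nonempty (I ∩ B) × ∣ I ─ B ∣ ≤ k ∸ ℓ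
𝓘-traced {k = k} {𝓕} uniform {t} {ℓ} {I} 1≤ℓ I∈𝓘
  with F , F' , (F∈𝓕 , maxBin≡ℓ) , F'∈𝓕 , F∩F'≡I ← ∈𝓘⁻ {𝓕 = 𝓕} {𝓑 k 𝓕} {t} {ℓ} {I} I∈𝓘
  with B , B∈𝓑 , B⊆F , ∣B∣≡ℓ ← maxBin≡⇒∃ (𝓑 k 𝓕) 1≤ℓ maxBin≡ℓ
  with y , y∈B∩F' ← proj₂ (∈𝓑⁻ k 𝓕 B∈𝓑) F' F'∈𝓕
  with y∈B , y∈F' ← x∈p∩q⁻ B F' y∈B∩F'
  = B , layer⁺ (𝓑 k 𝓕) B∈𝓑 ∣B∣≡ℓ
      , (y , x∈p∩q⁺ (subst (y ∈_) F∩F'≡I (x∈p∩q⁺ (B⊆F y∈B , y∈F')) , y∈B))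
      , subst₂ (λ f b → ∣ I ─ B ∣ ≤ f ∸ b) (uniform F F∈𝓕) ∣B∣≡ℓ
          (∣p─q∣≤∣r∣∸∣q∣ (subst (_⊆ F) F∩F'≡I (p∩q⊆p F F')) B⊆F)

m∸1*n*o<m*p*o : ∀ {m n o p} → 1 ≤ m → n ≤ p → 1 ≤ p → 1 ≤ o → (m ∸ 1) * n * o < m * p * o
m∸1*n*o<m*p*o {suc m} {n} {o} {p} _ n≤p 1≤p 1≤o = begin-strict
  m * n * o         ≤⟨ *-monoˡ-≤ o (*-monoʳ-≤ m n≤p) ⟩
  m * p * o         <⟨ m<n+m (m * p * o) (*-mono-≤ 1≤p 1≤o) ⟩
  p * o + m * p * o ≡⟨ sym (*-distribʳ-+ o p (m * p)) ⟩
  suc m * p * o     ∎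
  where open ≤-Reasoning

1≤m^n : ∀ {m} n → 1 ≤ m → 1 ≤ m ^ n
1≤m^n {m} n 1≤m = m^n>0 m {{>-nonZero 1≤m}} n

-- The partner F' in 𝓘 is only used as a member of 𝓕.
lemma3p1 : (n k : ℕ) → 2 * k < n → 4 ≤ 2 * k →
    (𝓕 : Family n) → IsUniform k 𝓕 → Saturated k 𝓕 →
    (t : ℕ) → IsMinSize (𝓑 k 𝓕) t →
    (ℓ : ℕ) → t ≤ ℓ → ℓ ≤ k →
    τ≥ 2 (upTo-layer (𝓑 k 𝓕) ℓ) →
    (# (𝓘 𝓕 (𝓑 k 𝓕) t ℓ) ≤ ((2 ^ ℓ) ∸ 1) * # (layer (𝓑 k 𝓕) ℓ) * sum (map (n C_) (upTo (1 + (k ∸ ℓ)))))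
    × (((2 ^ ℓ) ∸ 1) * # (layer (𝓑 k 𝓕) ℓ) * sum (map (n C_) (upTo (1 + (k ∸ ℓ))))
    < (2 ^ ℓ) * (ℓ ^ 2) * (k ^ (ℓ ∸ 2)) * sum (map (n C_) (upTo (1 + (k ∸ ℓ)))))
lemma3p1 n k 2k<n 4≤2k 𝓕 uniform saturated t _ ℓ _ ℓ≤k τ≥2 = first , second
  where
  L = # (layer (𝓑 k 𝓕) ℓ)
  S = sum (map (n C_) (upTo (1 + (k ∸ ℓ))))
  2≤k : 2 ≤ k
  2≤k = *-cancelˡ-≤ 2 4≤2k
  intersecting : Intersecting (𝓑 k 𝓕)
  intersecting = 𝓑-intersecting 2k<n (≤-trans (s≤s z≤n) 2≤k) saturated
  2≤ℓ : 2 ≤ ℓ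
  2≤ℓ = τ≥2⇒2≤ℓ intersecting τ≥2
  1≤ℓ : 1 ≤ ℓ
  1≤ℓ = ≤-trans (s≤s z≤n) 2≤ℓ
  first : # (𝓘 𝓕 (𝓑 k 𝓕) t ℓ) ≤ (2 ^ ℓ ∸ 1) * L * S
  first = begin
    # (𝓘 𝓕 (𝓑 k 𝓕) t ℓ)   ≤⟨ #traced≤ (layer (𝓑 k 𝓕) ℓ) (𝓘 𝓕 (𝓑 k 𝓕) t ℓ) ℓ (k ∸ ℓ)
                                (λ B B∈ → proj₂ (layer⁻ (𝓑 k 𝓕) {S = B} B∈))
                                (λ I → 𝓘-traced uniform {t = t} 1≤ℓ) ⟩
    L * ((2 ^ ℓ ∸ 1) * S) ≡⟨ sym (*-assoc L _ S) ⟩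
    L * (2 ^ ℓ ∸ 1) * S   ≡⟨ cong (_* S) (*-comm L _) ⟩
    (2 ^ ℓ ∸ 1) * L * S   ∎
    where open ≤-Reasoning
  second : (2 ^ ℓ ∸ 1) * L * S < 2 ^ ℓ * ℓ ^ 2 * k ^ (ℓ ∸ 2) * S
  second = begin-strict
    (2 ^ ℓ ∸ 1) * L * S
      <⟨ m∸1*n*o<m*p*o (1≤m^n ℓ (s≤s z≤n)) (#layer≤ uniform ℓ≤k intersecting τ≥2 2≤ℓ)
                       (*-mono-≤ (1≤m^n 2 1≤ℓ) (1≤m^n (ℓ ∸ 2) (≤-trans 1≤ℓ ℓ≤k))) (s≤s z≤n) ⟩
    2 ^ ℓ * (ℓ ^ 2 * k ^ (ℓ ∸ 2)) * S
      ≡⟨ cong (_* S) (sym (*-assoc (2 ^ ℓ) (ℓ ^ 2) _)) ⟩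
    2 ^ ℓ * ℓ ^ 2 * k ^ (ℓ ∸ 2) * S ∎
    where open ≤-Reasoning
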